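{- Let $K$ be a finite field of order $q$ and $s$ a positive integer with $\gcd(s,q-1)=1$. For any $k\in\mathbb{Z}_+$, any $b,t_1,\dots,t_k\in K^\times$ and any $a\in K$, \[Q^{(t_1,\dots,t_k)}_{a,b}=\frac{Q^{(a/b,t_1,\dots,t_k)}_{0,0}-Q^{(t_1,\dots,t_k)}_{0,0}}{q-1}.\]
   Context: For $k\in\mathbb{Z}_+$, $t=(t_1,\dots,t_k)\in K^k$ and $a,b\in K$, $Q^t_{a,b}$ denotes the number of $v=(v_1,\dots,v_k)\in K^k$ with $t_1v_1+\cdots+t_kv_k=a$ and $v_1^s+\cdots+v_k^s=b^s$. -}

module Defs where

open import Data.Nat using (ℕ; zero; suc)
open import Data.Fin using (Fin)
open import Data.List using (List; []; _∷_; map; concatMap; filter; length; allFin)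
open import Data.Vec using (Vec; []; _∷_)
open import Data.Product using (_×_)
open import Relation.Nullary using (¬_; Dec; _×-dec_)
open import Relation.Binary.PropositionalEquality using (_≡_)
open import Relation.Binary.Definitions using (DecidableEquality)
open import Algebra.Core using (Op₁; Op₂)
open import Algebra.Structures using (IsCommutativeRing)
open import Function.Bundles using (_↔_; Inverse)

record FiniteField : Set₁ where
  infixl 7 _*_
  infixl 6 _+_
  field
    Carrier : Set
    _+_ _*_ : Op₂ Carrier
    -_ : Op₁ Carrier
    0# 1# : Carrier
    _⁻¹ : Op₁ Carrier
    isCommutativeRing : IsCommutativeRing _≡_ _+_ _*_ -_ 0# 1#
    0≢1 : ¬ (0# ≡ 1#)
    ⁻¹-inverse : ∀ x → ¬ (x ≡ 0#) → x * (x ⁻¹) ≡ 1#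
    _≟_ : DecidableEquality Carrier
    q : ℕ
    enum : Fin q ↔ Carrier

  pow : Carrier → ℕ → Carrier
  pow x zero = 1#
  pow x (suc n) = x * pow x n

  elements : List Carrier
  elements = map (Inverse.to enum) (allFin q)

  allVecs : (k : ℕ) → List (Vec Carrier k)
  allVecs zero = [] ∷ []
  allVecs (suc k) = concatMap (λ x → map (x ∷_) (allVecs k)) elements

  dot : ∀ {k} → Vec Carrier k → Vec Carrier k → Carrier
  dot [] [] = 0#
  dot (t ∷ ts) (v ∷ vs) = t * v + dot ts vs

  powSum : ∀ {k} → ℕ → Vec Carrier k → Carrier
  powSum s [] = 0#
  powSum s (v ∷ vs) = pow v s + powSum s vs

  Q : (s : ℕ) → ∀ {k} → Vec Carrier k → Carrier → Carrier → ℕ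
  Q s t a b = length (filter (λ v → (dot t v ≟ a) ×-dec (powSum s v ≟ pow b s)) (allVecs _))

-- Split the solutions v ∈ K^{k+1} of (c, t)·v = 0, v₁ˢ + ⋯ + v_{k+1}ˢ = 0, where c = a/b, by their
-- first coordinate u. For u = 0 they are exactly the solutions counted by Q^t_{0,0}. For u ≠ 0 the
-- substitution v = (u, -(u/b) w) matches them bijectively with the w satisfying t·w = a and
-- Σ wᵢˢ = bˢ, since (-1)ˢ = -1: in characteristic 2 because -1 = 1, and otherwise because
-- q - 1 is even (x ↦ -x pairs off the nonzero elements) and coprime to s, so s is odd.
module Submission where

open import Defs
open import Data.Empty using (⊥-elim)
open import Data.List using (List; []; _∷_; map; filter; length; concatMap; _++_)
open import Data.List.Membership.Propositional using (_∈_)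
open import Data.List.Relation.Unary.Unique.Propositional using (Unique)
open import Data.List.Relation.Binary.Permutation.Propositional using (_↭_)
open import Data.Nat.ListAction using (sum)
open import Data.Product using (_×_; _,_)
open import Function using (_∘_)
open import Function.Bundles using (_⇔_; mk⇔; Equivalence)
open import Level using (0ℓ)
open import Relation.Nullary using (¬_; yes; no; ¬?; _⊎-dec_; _×-dec_)
open import Relation.Unary using (Pred; Decidable)
open import Relation.Binary.Definitions using (DecidableEquality)
open import Relation.Binary.PropositionalEquality

module Counting where

  open import Data.List.Relation.Unary.All as All using (All; []; _∷_)
  open import Data.List.Relation.Unary.Any using (here; there)
  open import Data.List.Relation.Unary.AllPairs using (_∷_)
  open import Data.Sum using (_⊎_; inj₁; inj₂)
  open import Relation.Binary.Definitions using (tri<; tri≈; tri>)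

  open import Data.Nat using (ℕ; suc; _+_; _*_; _<_)
  open import Data.Nat.Properties
    using (+-assoc; +-comm; +-suc; +-identityʳ; *-comm; <-cmp; <-irrefl; <-asym; _<?_; +-commutativeSemigroup)
  open import Algebra.Properties.CommutativeSemigroup +-commutativeSemigroup using (x∙yz≈y∙xz)
  open import Data.Nat.Divisibility using (_∣_; divides)
  open import Data.List.Properties using (filter-≐; filter-++; length-++; filter-all; filter-accept; filter-reject)
  open import Data.List.Relation.Binary.Permutation.Propositional.Properties using (filter-↭; ↭-length)

  count : {A : Set} {P : Pred A 0ℓ} → Decidable P → List A → ℕ
  count P? xs = length (filter P? xs)

  module _ {A : Set} where

    module _ {P Q : Pred A 0ℓ} (P? : Decidable P) (Q? : Decidable Q) where

      count-cong : (∀ x → P x ⇔ Q x) → ∀ xs → count P? xs ≡ count Q? xs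
      count-cong P⇔Q xs = cong length (filter-≐ P? Q? (Equivalence.to (P⇔Q _) , Equivalence.from (P⇔Q _)) xs)

      count-⊎ : (∀ {x} → P x → ¬ Q x) → ∀ xs →
        count (λ x → P? x ⊎-dec Q? x) xs ≡ count P? xs + count Q? xs
      count-⊎ P⇒¬Q [] = refl
      count-⊎ P⇒¬Q (x ∷ xs) with P? x | Q? x
      ... | yes p | yes q = ⊥-elim (P⇒¬Q p q)
      ... | yes _ | no _  = cong suc (count-⊎ P⇒¬Q xs)
      ... | no _  | yes _ = trans (cong suc (count-⊎ P⇒¬Q xs)) (sym (+-suc _ _))
      ... | no _  | no _  = count-⊎ P⇒¬Q xs

    module _ {P : Pred A 0ℓ} (P? : Decidable P) where

      count-map : {B : Set} (f : B → A) → ∀ xs → count P? (map f xs) ≡ count (P? ∘ f) xs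
      count-map f [] = refl
      count-map f (x ∷ xs) with P? (f x)
      ... | yes _ = cong suc (count-map f xs)
      ... | no _  = count-map f xs

      count-++ : ∀ xs ys → count P? (xs ++ ys) ≡ count P? xs + count P? ys
      count-++ xs ys = trans (cong length (filter-++ P? xs ys)) (length-++ (filter P? xs))

      count-concatMap : {B : Set} (f : B → List A) → ∀ xs →
        count P? (concatMap f xs) ≡ sum (map (λ x → count P? (f x)) xs)
      count-concatMap f [] = refl
      count-concatMap f (x ∷ xs) =
        trans (count-++ (f x) (concatMap f xs)) (cong (count P? (f x) +_) (count-concatMap f xs))

      count-↭ : ∀ {xs ys} → xs ↭ ys → count P? xs ≡ count P? ys
      count-↭ p = ↭-length (filter-↭ P? p)

    sum-map-const : (f : A → ℕ) {c : ℕ} → ∀ {xs} → All (λ x → f x ≡ c) xs → sum (map f xs) ≡ length xs * c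
    sum-map-const f [] = refl
    sum-map-const f (fx≡c ∷ fxs≡c) = cong₂ _+_ fx≡c (sum-map-const f fxs≡c)

    sum-map-≢-const : (f : A → ℕ) {z : A} {c : ℕ} → (∀ {x} → ¬ x ≡ z → f x ≡ c) →
      ∀ {xs} → Unique xs → z ∈ xs → sum (map f xs) + c ≡ f z + length xs * c
    sum-map-≢-const f {z} {c} f≡c {z ∷ xs} (z∉xs ∷ _) (here refl) = begin
      (f z + sum (map f xs)) + c  ≡⟨ cong (λ n → (f z + n) + c) (sum-map-const f (All.map (λ z≢x → f≡c (z≢x ∘ sym)) z∉xs)) ⟩
      (f z + length xs * c) + c   ≡⟨ +-assoc (f z) _ c ⟩
      f z + (length xs * c + c)   ≡⟨ cong (f z +_) (+-comm _ c) ⟩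
      f z + length (z ∷ xs) * c   ∎
      where open ≡-Reasoning
    sum-map-≢-const f {z} {c} f≡c {x ∷ xs} (x∉xs ∷ xs-unique) (there z∈xs) = begin
      (f x + sum (map f xs)) + c  ≡⟨ cong (λ n → (n + _) + c) (f≡c (All.lookup x∉xs z∈xs)) ⟩
      (c + sum (map f xs)) + c    ≡⟨ +-assoc c _ c ⟩
      c + (sum (map f xs) + c)    ≡⟨ cong (c +_) (sum-map-≢-const f f≡c xs-unique z∈xs) ⟩
      c + (f z + length xs * c)   ≡⟨ x∙yz≈y∙xz c (f z) _ ⟩
      f z + length (x ∷ xs) * c   ∎
      where open ≡-Reasoning

    module _ (_≟_ : DecidableEquality A) where

      count-≢-unique : ∀ {z xs} → Unique xs → z ∈ xs → suc (count (λ x → ¬? (x ≟ z)) xs) ≡ length xs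
      count-≢-unique {z} {z ∷ xs} (z∉xs ∷ _) (here refl) = begin
        suc (count ≢z? (z ∷ xs))  ≡⟨ cong (suc ∘ length) (filter-reject ≢z? (λ z≢z → z≢z refl)) ⟩
        suc (count ≢z? xs)        ≡⟨ cong (suc ∘ length) (filter-all ≢z? (All.map (_∘ sym) z∉xs)) ⟩
        suc (length xs)           ∎
        where
          open ≡-Reasoning
          ≢z? = λ x → ¬? (x ≟ z)
      count-≢-unique {z} {x ∷ xs} (x∉xs ∷ xs-unique) (there z∈xs) =
        trans (cong (suc ∘ length) (filter-accept (λ y → ¬? (y ≟ z)) (All.lookup x∉xs z∈xs)))
              (cong suc (count-≢-unique xs-unique z∈xs))

      module _ (rank : A → ℕ) (rank-injective : ∀ {x y} → rank x ≡ rank y → x ≡ y)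
               (ι : A → A) (ι-involutive : ∀ x → ι (ι x) ≡ x) where

        private
          Lower : Pred A 0ℓ
          Lower x = rank x < rank (ι x)

          lower? : Decidable Lower
          lower? x = rank x <? rank (ι x)

          moved⇔lower⊎ : ∀ x → (¬ x ≡ ι x) ⇔ (Lower x ⊎ Lower (ι x))
          moved⇔lower⊎ x = mk⇔ to from
            where
              to : ¬ x ≡ ι x → Lower x ⊎ Lower (ι x)
              to x≢ιx with <-cmp (rank x) (rank (ι x))
              ... | tri< x<ιx _ _ = inj₁ x<ιx
              ... | tri≈ _ x≈ιx _ = ⊥-elim (x≢ιx (rank-injective x≈ιx))
              ... | tri> _ _ ιx<x = inj₂ (subst (λ y → rank (ι x) < rank y) (sym (ι-involutive x)) ιx<x)
              from : Lower x ⊎ Lower (ι x) → ¬ x ≡ ι x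
              from (inj₁ x<ιx)   x≡ιx = <-irrefl (cong rank x≡ιx) x<ιx
              from (inj₂ ιx<ιιx) x≡ιx = <-irrefl (cong (rank ∘ ι) x≡ιx) ιx<ιιx

          lower⇒¬lower-ι : ∀ {x} → Lower x → ¬ Lower (ι x)
          lower⇒¬lower-ι {x} x<ιx ιx<ιιx =
            <-asym x<ιx (subst (λ y → rank (ι x) < rank y) (ι-involutive x) ιx<ιιx)

        -- Of each orbit {x, ι x} with x ≠ ι x exactly one element has the smaller rank.
        2∣count-moved : ∀ {xs} → map ι xs ↭ xs → 2 ∣ count (λ x → ¬? (x ≟ ι x)) xs
        2∣count-moved {xs} ιxs↭xs = divides (count lower? xs) (begin
          count (λ x → ¬? (x ≟ ι x)) xs                ≡⟨ count-cong _ _ moved⇔lower⊎ xs ⟩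
          count (λ x → lower? x ⊎-dec lower? (ι x)) xs  ≡⟨ count-⊎ lower? (lower? ∘ ι) lower⇒¬lower-ι xs ⟩
          count lower? xs + count (lower? ∘ ι) xs       ≡⟨ cong (count lower? xs +_) lower-ι≡lower ⟩
          count lower? xs + count lower? xs             ≡⟨ cong (count lower? xs +_) (sym (+-identityʳ _)) ⟩
          2 * count lower? xs                           ≡⟨ *-comm 2 (count lower? xs) ⟩
          count lower? xs * 2                           ∎)
          where
            open ≡-Reasoning
            lower-ι≡lower : count (lower? ∘ ι) xs ≡ count lower? xs
            lower-ι≡lower = trans (sym (count-map lower? ι xs)) (count-↭ lower? ιxs↭xs)

open Counting

module FiniteFieldProperties (F : FiniteField) where

  open FiniteField F
  open import Data.Nat as ℕ using (ℕ; zero; suc; _∸_)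
  open import Data.Nat.Divisibility using (_∣_; _∣0; n∣n; ∣m∣n⇒∣m+n; ∣1⇒≡1)
  open import Data.Nat.GCD using (gcd; gcd-greatest)
  open import Data.Fin using (toℕ)
  open import Data.Fin.Properties using (toℕ-injective)
  open import Data.List using (allFin)
  open import Data.List.Properties using (length-map; length-tabulate; map-cong; map-∘)
  open import Data.List.Membership.Propositional.Properties using (∈-map⁺; ∈-allFin)
  open import Data.List.Membership.Propositional.Properties.WithK using (unique∧set⇒bag)
  import Data.List.Relation.Unary.Unique.Propositional.Properties as Unique
  open import Data.List.Relation.Binary.BagAndSetEquality using (∼bag⇒↭)
  open import Data.List.Relation.Binary.Permutation.Propositional.Properties using (map⁺)
  open import Data.Nat.ListAction.Properties using (sum-↭)
  open import Data.Product.Function.NonDependent.Propositional using (_×-⇔_)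
  open import Data.Vec as Vec using (Vec; []; _∷_)
  open import Function.Bundles using (_↔_; Inverse; Injection; mk↔ₛ′)
  open import Function.Properties.Inverse using (↔⇒↣)
  open import Algebra.Bundles using (CommutativeRing)
  open import Function.Properties.Equivalence using () renaming (trans to ⇔-trans)

  commutativeRing : CommutativeRing 0ℓ 0ℓ
  commutativeRing = record { isCommutativeRing = isCommutativeRing }

  open CommutativeRing commutativeRing
    using (*-comm; *-assoc; *-identityˡ; *-identityʳ; zeroˡ; zeroʳ;
           +-identityˡ; -‿inverseʳ; distribˡ; distribʳ;
           ring; +-group; commutativeSemiring; *-commutativeSemigroup)
  open import Algebra.Properties.Ring ring using (-‿distribˡ-*; x[y-z]≈xy-xz; -1*x≈-x)
  open import Algebra.Properties.Group +-group using (⁻¹-involutive; ε⁻¹≈ε; x∙y⁻¹≈ε⇒x≈y; inverseʳ-unique)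
  open import Algebra.Properties.CommutativeSemiring.Exp commutativeSemiring using (_^_; ^-distrib-*)
  open import Algebra.Properties.CommutativeSemigroup *-commutativeSemigroup using (x∙yz≈y∙xz)

  NonZero : Carrier → Set
  NonZero x = ¬ x ≡ 0#

  *-cancelˡ-≡0 : ∀ {x y} → NonZero x → x * y ≡ 0# → y ≡ 0#
  *-cancelˡ-≡0 {x} {y} x≢0 xy≡0 = begin
    y               ≡⟨ sym (*-identityˡ y) ⟩
    1# * y          ≡⟨ cong (_* y) (sym (trans (*-comm (x ⁻¹) x) (⁻¹-inverse x x≢0))) ⟩
    (x ⁻¹ * x) * y  ≡⟨ *-assoc (x ⁻¹) x y ⟩
    x ⁻¹ * (x * y)  ≡⟨ cong (x ⁻¹ *_) xy≡0 ⟩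
    x ⁻¹ * 0#       ≡⟨ zeroʳ (x ⁻¹) ⟩
    0#              ∎
    where open ≡-Reasoning

  *-nonZero : ∀ {x y} → NonZero x → NonZero y → NonZero (x * y)
  *-nonZero x≢0 y≢0 xy≡0 = y≢0 (*-cancelˡ-≡0 x≢0 xy≡0)

  ⁻¹-nonZero : ∀ {x} → NonZero x → NonZero (x ⁻¹)
  ⁻¹-nonZero {x} x≢0 x⁻¹≡0 =
    0≢1 (trans (sym (zeroʳ x)) (trans (cong (x *_) (sym x⁻¹≡0)) (⁻¹-inverse x x≢0)))

  -‿nonZero : ∀ {x} → NonZero x → NonZero (- x)
  -‿nonZero {x} x≢0 -x≡0 = x≢0 (trans (sym (⁻¹-involutive x)) (trans (cong -_ -x≡0) ε⁻¹≈ε))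

  x*y+-x*z≡0⇔z≡y : ∀ {x y z} → NonZero x → (x * y + - x * z ≡ 0#) ⇔ (z ≡ y)
  x*y+-x*z≡0⇔z≡y {x} {y} {z} x≢0 = mk⇔
    (λ e → sym (x∙y⁻¹≈ε⇒x≈y y z (*-cancelˡ-≡0 x≢0 (trans factor e))))
    (λ { refl → trans (sym factor) (trans (cong (x *_) (-‿inverseʳ y)) (zeroʳ x)) })
    where
      factor : x * (y + - z) ≡ x * y + - x * z
      factor = trans (x[y-z]≈xy-xz x y z) (cong (x * y +_) (-‿distribˡ-* x z))

  pow≡^ : ∀ x n → pow x n ≡ x ^ n
  pow≡^ x zero    = refl
  pow≡^ x (suc n) = cong (x *_) (pow≡^ x n)

  pow-distrib-* : ∀ x y n → pow (x * y) n ≡ pow x n * pow y n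
  pow-distrib-* x y n = begin
    pow (x * y) n      ≡⟨ pow≡^ (x * y) n ⟩
    (x * y) ^ n        ≡⟨ ^-distrib-* x y n ⟩
    x ^ n * y ^ n      ≡⟨ sym (cong₂ _*_ (pow≡^ x n) (pow≡^ y n)) ⟩
    pow x n * pow y n  ∎
    where open ≡-Reasoning

  pow-nonZero : ∀ {x} n → NonZero x → NonZero (pow x n)
  pow-nonZero zero    x≢0 = 0≢1 ∘ sym
  pow-nonZero (suc n) x≢0 = *-nonZero x≢0 (pow-nonZero n x≢0)

  pow-0# : ∀ n → pow 0# (suc n) ≡ 0#
  pow-0# n = zeroˡ (pow 0# n)

  pow-1# : ∀ n → pow 1# n ≡ 1#
  pow-1# zero    = refl
  pow-1# (suc n) = trans (cong (1# *_) (pow-1# n)) (*-identityˡ 1#)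

  pow-odd-involutive : ∀ {x} → x * x ≡ 1# → ∀ n → ¬ 2 ∣ n → pow x n ≡ x
  pow-odd-involutive x*x≡1 zero 2∤0 = ⊥-elim (2∤0 (2 ∣0))
  pow-odd-involutive {x} x*x≡1 (suc zero) _ = *-identityʳ x
  pow-odd-involutive {x} x*x≡1 (suc (suc n)) 2∤2+n = begin
    x * (x * pow x n)  ≡⟨ sym (*-assoc x x (pow x n)) ⟩
    (x * x) * pow x n  ≡⟨ cong (_* pow x n) x*x≡1 ⟩
    1# * pow x n       ≡⟨ *-identityˡ (pow x n) ⟩
    pow x n            ≡⟨ pow-odd-involutive x*x≡1 n (2∤2+n ∘ ∣m∣n⇒∣m+n n∣n) ⟩
    x                  ∎
    where open ≡-Reasoning

  rank : Carrier → ℕ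
  rank x = toℕ (Inverse.from enum x)

  rank-injective : ∀ {x y} → rank x ≡ rank y → x ≡ y
  rank-injective {x} {y} e = begin
    x                                   ≡⟨ sym (Inverse.strictlyInverseˡ enum x) ⟩
    Inverse.to enum (Inverse.from enum x) ≡⟨ cong (Inverse.to enum) (toℕ-injective e) ⟩
    Inverse.to enum (Inverse.from enum y) ≡⟨ Inverse.strictlyInverseˡ enum y ⟩
    y                                   ∎
    where open ≡-Reasoning

  elements-unique : Unique elements
  elements-unique = Unique.map⁺ (Injection.injective (↔⇒↣ enum)) (Unique.allFin⁺ q)

  ∈-elements : ∀ x → x ∈ elements
  ∈-elements x = subst (_∈ elements) (Inverse.strictlyInverseˡ enum x)
                       (∈-map⁺ (Inverse.to enum) (∈-allFin (Inverse.from enum x)))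

  length-elements : length elements ≡ q
  length-elements = trans (length-map (Inverse.to enum) (allFin q)) (length-tabulate (λ i → i))

  map-elements-↭ : (σ : Carrier ↔ Carrier) → map (Inverse.to σ) elements ↭ elements
  map-elements-↭ σ = ∼bag⇒↭ (unique∧set⇒bag (Unique.map⁺ (Injection.injective (↔⇒↣ σ)) elements-unique) elements-unique
    (λ {x} → mk⇔ (λ _ → ∈-elements x)
                 (λ _ → subst (_∈ map (Inverse.to σ) elements) (Inverse.strictlyInverseˡ σ x)
                              (∈-map⁺ (Inverse.to σ) (∈-elements (Inverse.from σ x))))))

  count-nonZero-elements : suc (count (λ x → ¬? (x ≟ 0#)) elements) ≡ q
  count-nonZero-elements = trans (count-≢-unique _≟_ elements-unique (∈-elements 0#)) length-elements

  q≡1+[q∸1] : q ≡ suc (q ∸ 1)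
  q≡1+[q∸1] = subst (λ n → n ≡ suc (n ∸ 1)) count-nonZero-elements refl

  -‿↔ : Carrier ↔ Carrier
  -‿↔ = mk↔ₛ′ -_ -_ ⁻¹-involutive ⁻¹-involutive

  *-↔ : ∀ {μ} → NonZero μ → Carrier ↔ Carrier
  *-↔ {μ} μ≢0 = mk↔ₛ′ (μ *_) (μ ⁻¹ *_) (cancel μ (μ ⁻¹) (⁻¹-inverse μ μ≢0))
                                        (cancel (μ ⁻¹) μ (trans (*-comm (μ ⁻¹) μ) (⁻¹-inverse μ μ≢0)))
    where
      cancel : ∀ x y → x * y ≡ 1# → ∀ z → x * (y * z) ≡ z
      cancel x y xy≡1 z = trans (sym (*-assoc x y z)) (trans (cong (_* z) xy≡1) (*-identityˡ z))

  2∣q∸1 : ¬ 1# + 1# ≡ 0# → 2 ∣ q ∸ 1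
  2∣q∸1 2≢0 = subst (2 ∣_) (cong (_∸ 1) count-nonZero-elements)
    (subst (2 ∣_) (count-cong _ _ moved⇔nonZero elements)
      (2∣count-moved _≟_ rank rank-injective -_ ⁻¹-involutive (map-elements-↭ -‿↔)))
    where
      x≡-x⇒x≡0 : ∀ {x} → x ≡ - x → x ≡ 0#
      x≡-x⇒x≡0 {x} x≡-x = *-cancelˡ-≡0 2≢0 (begin
        (1# + 1#) * x      ≡⟨ distribʳ x 1# 1# ⟩
        1# * x + 1# * x    ≡⟨ cong₂ _+_ (*-identityˡ x) (trans (*-identityˡ x) x≡-x) ⟩
        x + - x            ≡⟨ -‿inverseʳ x ⟩
        0#                 ∎)
        where open ≡-Reasoning
      moved⇔nonZero : ∀ x → (¬ x ≡ - x) ⇔ NonZero x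
      moved⇔nonZero x = mk⇔ (λ x≢-x x≡0 → x≢-x (trans x≡0 (trans (sym ε⁻¹≈ε) (cong -_ (sym x≡0)))))
                            (λ x≢0 → x≢0 ∘ x≡-x⇒x≡0)

  pow-[-1#]-coprime : ∀ s → gcd s (q ∸ 1) ≡ 1 → pow (- 1#) s ≡ - 1#
  pow-[-1#]-coprime s coprime with (1# + 1#) ≟ 0#
  ... | yes 2≡0 = trans (cong (λ x → pow x s) -1≡1) (trans (pow-1# s) (sym -1≡1))
    where
      -1≡1 : - 1# ≡ 1#
      -1≡1 = sym (inverseʳ-unique 1# 1# 2≡0)
  ... | no 2≢0 = pow-odd-involutive (trans (-1*x≈-x (- 1#)) (⁻¹-involutive 1#)) s 2∤s
    where
      2∤s : ¬ 2 ∣ s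
      2∤s 2∣s with ∣1⇒≡1 (subst (2 ∣_) coprime (gcd-greatest 2∣s (2∣q∸1 2≢0)))
      ... | ()

  pow-neg : ∀ s → pow (- 1#) s ≡ - 1# → ∀ x → pow (- x) s ≡ - pow x s
  pow-neg s [-1]ˢ≡-1 x = begin
    pow (- x) s              ≡⟨ cong (λ y → pow y s) (sym (-1*x≈-x x)) ⟩
    pow (- 1# * x) s         ≡⟨ pow-distrib-* (- 1#) x s ⟩
    pow (- 1#) s * pow x s   ≡⟨ cong (_* pow x s) [-1]ˢ≡-1 ⟩
    - 1# * pow x s           ≡⟨ -1*x≈-x (pow x s) ⟩
    - pow x s                ∎
    where open ≡-Reasoning

  count-allVecs-suc : ∀ {k} {P : Pred (Vec Carrier (suc k)) 0ℓ} (P? : Decidable P) →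
    count P? (allVecs (suc k)) ≡ sum (map (λ x → count (P? ∘ (x ∷_)) (allVecs k)) elements)
  count-allVecs-suc {k} P? = trans (count-concatMap P? _ elements)
    (cong sum (map-cong (λ x → count-map P? (x ∷_) (allVecs k)) elements))

  count-allVecs-map : (σ : Carrier ↔ Carrier) → ∀ k {P : Pred (Vec Carrier k) 0ℓ} (P? : Decidable P) →
    count (P? ∘ Vec.map (Inverse.to σ)) (allVecs k) ≡ count P? (allVecs k)
  count-allVecs-map σ zero P? with P? []
  ... | yes _ = refl
  ... | no _  = refl
  count-allVecs-map σ (suc k) P? = begin
    count (P? ∘ Vec.map σ′) (allVecs (suc k))                        ≡⟨ count-allVecs-suc (P? ∘ Vec.map σ′) ⟩
    sum (map (λ x → count (P? ∘ Vec.map σ′ ∘ (x ∷_)) (allVecs k)) elements)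
      ≡⟨ cong sum (map-cong (λ x → count-allVecs-map σ k (P? ∘ (σ′ x ∷_))) elements) ⟩
    sum (map (fibre ∘ σ′) elements)                                  ≡⟨ cong sum (map-∘ elements) ⟩
    sum (map fibre (map σ′ elements))                                ≡⟨ sum-↭ (map⁺ fibre (map-elements-↭ σ)) ⟩
    sum (map fibre elements)                                         ≡⟨ sym (count-allVecs-suc P?) ⟩
    count P? (allVecs (suc k))                                       ∎
    where
      open ≡-Reasoning
      σ′ = Inverse.to σ
      fibre : Carrier → ℕ
      fibre x = count (P? ∘ (x ∷_)) (allVecs k)

  dot-map-* : ∀ {k} μ (t w : Vec Carrier k) → dot t (Vec.map (μ *_) w) ≡ μ * dot t w
  dot-map-* μ [] [] = sym (zeroʳ μ)
  dot-map-* μ (tᵢ ∷ t) (wᵢ ∷ w) = begin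
    tᵢ * (μ * wᵢ) + dot t (Vec.map (μ *_) w)  ≡⟨ cong₂ _+_ (x∙yz≈y∙xz tᵢ μ wᵢ) (dot-map-* μ t w) ⟩
    μ * (tᵢ * wᵢ) + μ * dot t w               ≡⟨ sym (distribˡ μ _ _) ⟩
    μ * (tᵢ * wᵢ + dot t w)                   ∎
    where open ≡-Reasoning

  powSum-map-* : ∀ {k} s μ (w : Vec Carrier k) → powSum s (Vec.map (μ *_) w) ≡ pow μ s * powSum s w
  powSum-map-* s μ [] = sym (zeroʳ _)
  powSum-map-* s μ (wᵢ ∷ w) = begin
    pow (μ * wᵢ) s + powSum s (Vec.map (μ *_) w)  ≡⟨ cong₂ _+_ (pow-distrib-* μ wᵢ s) (powSum-map-* s μ w) ⟩
    pow μ s * pow wᵢ s + pow μ s * powSum s w     ≡⟨ sym (distribˡ (pow μ s) _ _) ⟩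
    pow μ s * (pow wᵢ s + powSum s w)             ∎
    where open ≡-Reasoning

  Solution : ℕ → ∀ {k} → Vec Carrier k → Carrier → Carrier → Pred (Vec Carrier k) 0ℓ
  Solution s t a b v = dot t v ≡ a × powSum s v ≡ pow b s

  solution? : ∀ s {k} (t : Vec Carrier k) a b → Decidable (Solution s t a b)
  solution? s t a b v = (dot t v ≟ a) ×-dec (powSum s v ≟ pow b s)


  private
    ≡-⇔ : ∀ {x x′ y y′ : Carrier} → x ≡ x′ → y ≡ y′ → (x ≡ y) ⇔ (x′ ≡ y′)
    ≡-⇔ x≡x′ y≡y′ = mk⇔ (λ x≡y → trans (sym x≡x′) (trans x≡y y≡y′))
                        (λ x′≡y′ → trans x≡x′ (trans x′≡y′ (sym y≡y′)))

  fibre-0# : ∀ s {k} c (t : Vec Carrier k) →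
    count (solution? (suc s) (c ∷ t) 0# 0# ∘ (0# ∷_)) (allVecs k) ≡ Q (suc s) t 0# 0#
  fibre-0# s c t = count-cong _ _ (λ w → ≡-⇔ (c*0+x≡x (dot t w)) refl ×-⇔ ≡-⇔ (0ˢ+x≡x (powSum (suc s) w)) refl) (allVecs _)
    where
      c*0+x≡x : ∀ x → c * 0# + x ≡ x
      c*0+x≡x x = trans (cong (_+ x) (zeroʳ c)) (+-identityˡ x)
      0ˢ+x≡x : ∀ x → pow 0# (suc s) + x ≡ x
      0ˢ+x≡x x = trans (cong (_+ x) (pow-0# s)) (+-identityˡ x)

  fibre-nonZero : ∀ s → pow (- 1#) (suc s) ≡ - 1# → ∀ {k} (t : Vec Carrier k) a {b u} → NonZero b → NonZero u →
    count (solution? (suc s) (a * b ⁻¹ ∷ t) 0# 0# ∘ (u ∷_)) (allVecs k) ≡ Q (suc s) t a b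
  fibre-nonZero s [-1]ˢ≡-1 {k} t a {b} {u} b≢0 u≢0 = begin
    count (solution? (suc s) (c ∷ t) 0# 0# ∘ (u ∷_)) (allVecs k)
      ≡⟨ sym (count-allVecs-map (*-↔ (-‿nonZero λ≢0)) k _) ⟩
    count (solution? (suc s) (c ∷ t) 0# 0# ∘ (u ∷_) ∘ Vec.map (μ *_)) (allVecs k)
      ≡⟨ count-cong _ _ (λ w → linear w ×-⇔ power w) (allVecs k) ⟩
    Q (suc s) t a b ∎
    where
      open ≡-Reasoning
      c = a * b ⁻¹
      λ′ = u * b ⁻¹
      μ = - λ′
      λ≢0 : NonZero λ′
      λ≢0 = *-nonZero u≢0 (⁻¹-nonZero b≢0)
      c*u≡λ*a : c * u ≡ λ′ * a
      c*u≡λ*a = trans (*-comm c u) (trans (cong (u *_) (*-comm a (b ⁻¹))) (sym (*-assoc u (b ⁻¹) a)))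
      λ*b≡u : λ′ * b ≡ u
      λ*b≡u = trans (*-assoc u (b ⁻¹) b)
                (trans (cong (u *_) (trans (*-comm (b ⁻¹) b) (⁻¹-inverse b b≢0))) (*-identityʳ u))
      linear : ∀ w → (c * u + dot t (Vec.map (μ *_) w) ≡ 0#) ⇔ (dot t w ≡ a)
      linear w = ⇔-trans (≡-⇔ (cong₂ _+_ c*u≡λ*a (dot-map-* μ t w)) refl) (x*y+-x*z≡0⇔z≡y λ≢0)
      power : ∀ w → (pow u (suc s) + powSum (suc s) (Vec.map (μ *_) w) ≡ pow 0# (suc s))
                      ⇔ (powSum (suc s) w ≡ pow b (suc s))
      power w = ⇔-trans (≡-⇔ (cong₂ _+_ uˢ≡λˢbˢ μˢS≡-λˢS) (pow-0# s)) (x*y+-x*z≡0⇔z≡y (pow-nonZero (suc s) λ≢0))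
        where
          uˢ≡λˢbˢ : pow u (suc s) ≡ pow λ′ (suc s) * pow b (suc s)
          uˢ≡λˢbˢ = trans (cong (λ x → pow x (suc s)) (sym λ*b≡u)) (pow-distrib-* λ′ b (suc s))
          μˢS≡-λˢS : powSum (suc s) (Vec.map (μ *_) w) ≡ - pow λ′ (suc s) * powSum (suc s) w
          μˢS≡-λˢS = trans (powSum-map-* (suc s) μ w) (cong (_* powSum (suc s) w) (pow-neg (suc s) [-1]ˢ≡-1 λ′))

  Q-cons-0#-0# : ∀ s → gcd (suc s) (q ∸ 1) ≡ 1 → ∀ {k} (t : Vec Carrier k) a {b} → NonZero b →
    Q (suc s) (a * b ⁻¹ ∷ t) 0# 0# ℕ.+ Q (suc s) t a b ≡ Q (suc s) t 0# 0# ℕ.+ suc (q ∸ 1) ℕ.* Q (suc s) t a b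
  Q-cons-0#-0# s coprime {k} t a {b} b≢0 = begin
    Q (suc s) (c ∷ t) 0# 0# ℕ.+ Qab          ≡⟨ cong (ℕ._+ Qab) (count-allVecs-suc (solution? (suc s) (c ∷ t) 0# 0#)) ⟩
    sum (map fibre elements) ℕ.+ Qab          ≡⟨ sum-map-≢-const fibre fibre≡Qab elements-unique (∈-elements 0#) ⟩
    fibre 0# ℕ.+ length elements ℕ.* Qab      ≡⟨ cong₂ (λ x n → x ℕ.+ n ℕ.* Qab) (fibre-0# s c t) (trans length-elements q≡1+[q∸1]) ⟩
    Q (suc s) t 0# 0# ℕ.+ suc (q ∸ 1) ℕ.* Qab ∎
    where
      open ≡-Reasoning
      c = a * b ⁻¹
      Qab = Q (suc s) t a b
      fibre : Carrier → ℕ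
      fibre u = count (solution? (suc s) (c ∷ t) 0# 0# ∘ (u ∷_)) (allVecs k)
      fibre≡Qab : ∀ {u} → NonZero u → fibre u ≡ Qab
      fibre≡Qab = fibre-nonZero s (pow-[-1#]-coprime (suc s) coprime) t a b≢0


open import Data.Nat using (ℕ; suc; _+_; _*_; _∸_; _≥_; s≤s)
open import Data.Nat.Properties using (+-cancelʳ-≡)
open import Data.Nat.Tactic.RingSolver using (solve-∀)
open import Data.Nat.GCD using (gcd)
open import Data.Vec using (Vec; _∷_)
open import Data.Vec.Relation.Unary.All using (All)
open FiniteField using (Carrier; 0#; _⁻¹; q; Q)

private
  x+y≡z+[1+n]*y⇒y*n+z≡x : ∀ x y z n → x + y ≡ z + suc n * y → y * n + z ≡ x
  x+y≡z+[1+n]*y⇒y*n+z≡x x y z n h = +-cancelʳ-≡ y (y * n + z) x (trans (rearrange y z n) (sym h))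
    where
      rearrange : ∀ y z n → (y * n + z) + y ≡ z + (1 + n) * y
      rearrange = solve-∀

lemma4p6 : (F : FiniteField) →
    (s : ℕ) → s ≥ 1 → gcd s (q F ∸ 1) ≡ 1 →
    (k : ℕ) → k ≥ 1 →
    (t : Vec (Carrier F) k) → All (λ ti → ¬ (ti ≡ 0# F)) t →
    (a b : Carrier F) → ¬ (b ≡ 0# F) →
    Q F s t a b * (q F ∸ 1) + Q F s t (0# F) (0# F)
      ≡ Q F s ((FiniteField._*_ F a (_⁻¹ F b)) ∷ t) (0# F) (0# F)
lemma4p6 F (suc s) (s≤s _) coprime k _ t _ a b b≢0 =
  x+y≡z+[1+n]*y⇒y*n+z≡x _ (Q F (suc s) t a b) (Q F (suc s) t (0# F) (0# F)) (q F ∸ 1)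
    (FiniteFieldProperties.Q-cons-0#-0# F s coprime t a b≢0)
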